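{- For all $n\ge1$ and $k\ge0$, the map sending a word $w_1\cdots w_n\in L_{\mathrm{Rect}}$ to the permutation $\psi_{w_1}\circ\cdots\circ\psi_{w_n}(e_0)$ restricts to a bijection from the set of words in $L_{\mathrm{Rect}}$ of length $n$ containing exactly $k$ occurrences of the letter $d$ onto the set of rectangular permutations in $S_n$ with exactly $k$ recoils.
   Context: Permutations are in one-line form; $S_0$ consists of the empty permutation $e_0$. A recoil of $\pi\in S_n$ is a value $i\in\{1,\dots,n-1\}$ such that $i$ occurs after $i+1$ in $\pi$. A permutation is rectangular if it avoids each of $2413, 2431, 4213, 4231$. For $\pi\in S_n$, $1\le i,j\le n+1$, $\rho_{i,j}(\pi)\in S_{n+1}$ increases by $1$ every entry $\ge i$ and inserts the value $i$ at position $j$. $\psi_1=\rho_{1,1}$ with domain all rectangular permutations; $\psi_2=\rho_{1,2}$ with domain the rectangular $\pi$ of size $\ge2$ with $\pi_1\ne1$; $\psi_u(\pi)=\rho_{\pi_1,1}(\pi)$ with domain the rectangular $\pi$ of size $\ge2$ with $\pi_1\ne1$; $\psi_d(\pi)=\rho_{\pi_1+1,1}(\pi)$ with domain the rectangular $\pi$ of size $\ge1$. $L_{\mathrm{Rect}}$ is the set of nonempty words $w_1\cdots w_m$ over $\{1,2,u,d\}$ such that, with $\sigma_0=e_0$ and $\sigma_j=\psi_{w_{m-j+1}}(\sigma_{j-1})$, each $\sigma_{j-1}$ lies in the domain of $\psi_{w_{m-j+1}}$. -}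

module Defs where

open import Data.Nat using (ℕ; zero; suc; _+_; _∸_; _<_; _≤_; _≡ᵇ_; _≤ᵇ_; _<ᵇ_)
open import Data.Bool using (Bool; true; false; if_then_else_)
open import Data.List using (List; []; _∷_; map; upTo; length; take; drop; _++_)
open import Data.List.Relation.Binary.Sublist.Propositional using (_⊆_)
open import Data.List.Relation.Binary.Permutation.Propositional using (_↭_)
open import Data.Product using (_×_; ∃; ∃-syntax)
open import Data.Unit using (⊤)
open import Relation.Nullary using (¬_)
open import Relation.Binary.PropositionalEquality using (_≡_)
open import Function.Bundles using (_⇔_)

-- Permutations in one-line form are lists of naturals.
Perm : Set
Perm = List ℕ

oneTo : ℕ → List ℕ
oneTo n = map suc (upTo n)

IsPerm : ℕ → Perm → Set
IsPerm n π = π ↭ oneTo n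

-- entry at 0-based position i (default 0 out of range)
at : List ℕ → ℕ → ℕ
at [] _ = 0
at (x ∷ xs) zero = x
at (x ∷ xs) (suc i) = at xs i

OrderIso : List ℕ → List ℕ → Set
OrderIso s p = (length s ≡ length p) ×
  (∀ i j → i < length s → j < length s → (at s i < at s j) ⇔ (at p i < at p j))

Contains : Perm → Perm → Set
Contains π p = ∃[ s ] ((s ⊆ π) × OrderIso s p)

Avoids : Perm → Perm → Set
Avoids π p = ¬ Contains π p

Rectangular : Perm → Set
Rectangular π =
  Avoids π (2 ∷ 4 ∷ 1 ∷ 3 ∷ []) × Avoids π (2 ∷ 4 ∷ 3 ∷ 1 ∷ []) ×
  Avoids π (4 ∷ 2 ∷ 1 ∷ 3 ∷ []) × Avoids π (4 ∷ 2 ∷ 3 ∷ 1 ∷ [])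

posOf : ℕ → List ℕ → ℕ
posOf x [] = 0
posOf x (y ∷ ys) = if x ≡ᵇ y then 0 else suc (posOf x ys)

countTrue : List Bool → ℕ
countTrue [] = 0
countTrue (true ∷ bs) = suc (countTrue bs)
countTrue (false ∷ bs) = countTrue bs

recoils : Perm → ℕ
recoils π = countTrue (map (λ i → posOf (suc i) π <ᵇ posOf i π) (oneTo (length π ∸ 1)))

-- ρ_{i,j}: increase entries ≥ i by one, insert i at (1-based) position j
ρ : ℕ → ℕ → Perm → Perm
ρ i j π = let π' = map (λ x → if i ≤ᵇ x then suc x else x) π
          in take (j ∸ 1) π' ++ (i ∷ drop (j ∸ 1) π')

data Letter : Set where
  L1 L2 Lu Ld : Letter

first : Perm → ℕ
first [] = 0
first (x ∷ _) = x

ψ : Letter → Perm → Perm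
ψ L1 π = ρ 1 1 π
ψ L2 π = ρ 1 2 π
ψ Lu π = ρ (first π) 1 π
ψ Ld π = ρ (suc (first π)) 1 π

InDomain : Letter → Perm → Set
InDomain L1 π = Rectangular π
InDomain L2 π = Rectangular π × 2 ≤ length π × ¬ (first π ≡ 1)
InDomain Lu π = Rectangular π × 2 ≤ length π × ¬ (first π ≡ 1)
InDomain Ld π = Rectangular π × 1 ≤ length π

Word : Set
Word = List Letter

-- ψ_{w1} ∘ ⋯ ∘ ψ_{wm} (e_0)
eval : Word → Perm
eval [] = []
eval (l ∷ w) = ψ l (eval w)

Valid : Word → Set
Valid [] = ⊤
Valid (l ∷ w) = Valid w × InDomain l (eval w)

InLRect : Word → Set
InLRect w = ¬ (w ≡ []) × Valid w

countD : Word → ℕ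
countD [] = 0
countD (Ld ∷ w) = suc (countD w)
countD (_ ∷ w) = countD w

WordSet : ℕ → ℕ → Word → Set
WordSet n k w = InLRect w × length w ≡ n × countD w ≡ k

PermSet : ℕ → ℕ → Perm → Set
PermSet n k π = IsPerm n π × Rectangular π × recoils π ≡ k

-- Each ψ adds one new value: ψ₁ and ψ₂ insert 1 at the front or in second place, while
-- ψ_u and ψ_d put π₁ resp. π₁ + 1 in front, adjacent in value to the (shifted) old first entry.
-- In each of 2413, 2431, 4213, 4231 the first two entries lie above some later entry and some
-- later entry lies strictly between them, so no occurrence of these patterns can use the new
-- entry, and rectangularity is preserved. Only ψ_d changes the number of recoils, raising it
-- by one. Conversely, the first two entries of a rectangular permutation of size ≥ 2 are
-- 1 x, x 1, a (a+1) or (a+1) a (otherwise 1 and the successor of the smaller one complete a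
-- forbidden pattern); this shape determines the last letter applied and its preimage, so
-- letters can be peeled off one at a time.

module Submission where

open import Defs
open import Data.Nat
open import Data.Nat.Properties
open import Data.Bool using (Bool; true; false; T; if_then_else_)
open import Data.Bool.Properties using (T-≡)
open import Data.List using (List; []; _∷_; map; upTo; applyUpTo; length; take; drop; _++_)
open import Data.List.Properties using (map-∘; map-id; map-cong; map-upTo; take++drop≡id; length-map; length-upTo)
open import Data.List.Membership.Propositional using (_∈_; _∉_)
open import Data.List.Membership.Propositional.Properties using (∈-map⁺; ∈-map⁻; ∈-upTo⁺; ∈-upTo⁻)
open import Data.List.Relation.Unary.Any using (here; there)
open import Data.List.Relation.Unary.All using ([]; _∷_)
open import Data.List.Relation.Unary.All.Properties using (All¬⇒¬Any)
open import Data.List.Relation.Unary.AllPairs using ([]; _∷_)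
open import Data.List.Relation.Unary.Unique.Propositional using (Unique)
open import Data.List.Relation.Unary.Unique.Propositional.Properties using (upTo⁺) renaming (map⁺ to Unique-map⁺)
open import Data.List.Relation.Binary.Permutation.Propositional
  using (_↭_; ↭-refl; ↭-sym; ↭-trans; prep; swap; ↭⇒↭ₛ; module PermutationReasoning)
open import Data.List.Relation.Binary.Permutation.Propositional.Properties
  using (shift; drop-∷; ∈-resp-↭; ↭-length; ↭-empty-inv) renaming (map⁺ to ↭-map⁺)
open import Relation.Binary.PropositionalEquality
  using (_≡_; _≢_; refl; sym; trans; cong; cong₂; subst; subst₂; setoid; module ≡-Reasoning)
open import Data.List.Relation.Binary.Permutation.Setoid.Properties (setoid ℕ) using (Unique-resp-↭)
open import Data.List.Relation.Binary.Sublist.Propositional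
  using (_⊆_; []; _∷_; _∷ʳ_; ⊆-refl; ⊆-trans; lookup; from∈)
open import Data.List.Relation.Binary.Sublist.Propositional.Properties using () renaming (map⁺ to ⊆-map⁺)
open import Data.Product using (_×_; _,_; proj₁; proj₂; ∃-syntax; Σ-syntax)
open import Data.Sum using (_⊎_; inj₁; inj₂; [_,_]) renaming (swap to ⊎-swap)
open import Data.Empty using (⊥; ⊥-elim)
open import Data.Unit using (tt)
open import Function using (_∘_)
open import Function.Bundles using (_⇔_; mk⇔; Equivalence)
open import Function.Properties.Equivalence using () renaming (refl to ⇔-refl; sym to ⇔-sym; trans to ⇔-trans)
open import Relation.Nullary using (¬_; yes; no)
open import Relation.Binary.Definitions using (tri<; tri≈; tri>)

T-false : ∀ {b} → ¬ T b → b ≡ false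
T-false {true} ¬t = ⊥-elim (¬t tt)
T-false {false} _ = refl

<ᵇ-true : ∀ {m n} → m < n → (m <ᵇ n) ≡ true
<ᵇ-true m<n = Equivalence.to T-≡ (<⇒<ᵇ m<n)

<ᵇ-false : ∀ {m n} → ¬ m < n → (m <ᵇ n) ≡ false
<ᵇ-false {m} {n} m≮n = T-false (m≮n ∘ <ᵇ⇒< m n)

≤ᵇ-true : ∀ {m n} → m ≤ n → (m ≤ᵇ n) ≡ true
≤ᵇ-true m≤n = Equivalence.to T-≡ (≤⇒≤ᵇ m≤n)

≤ᵇ-false : ∀ {m n} → ¬ m ≤ n → (m ≤ᵇ n) ≡ false
≤ᵇ-false {m} {n} m≰n = T-false (m≰n ∘ ≤ᵇ⇒≤ m n)

≡ᵇ-true : ∀ {m n} → m ≡ n → (m ≡ᵇ n) ≡ true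
≡ᵇ-true {m} {n} m≡n = Equivalence.to T-≡ (≡⇒≡ᵇ m n m≡n)

≡ᵇ-false : ∀ {m n} → m ≢ n → (m ≡ᵇ n) ≡ false
≡ᵇ-false {m} {n} m≢n = T-false (m≢n ∘ ≡ᵇ⇒≡ m n)

shiftFrom : ℕ → ℕ → ℕ
shiftFrom i x = if i ≤ᵇ x then suc x else x

shiftFrom-≥ : ∀ {i x} → i ≤ x → shiftFrom i x ≡ suc x
shiftFrom-≥ i≤x rewrite ≤ᵇ-true i≤x = refl

shiftFrom-< : ∀ {i x} → x < i → shiftFrom i x ≡ x
shiftFrom-< x<i rewrite ≤ᵇ-false (<⇒≱ x<i) = refl

shiftFrom-mono-< : ∀ i {x y} → x < y → shiftFrom i x < shiftFrom i y
shiftFrom-mono-< i {x} {y} x<y with i ≤? x | i ≤? y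
... | yes i≤x | yes i≤y rewrite shiftFrom-≥ i≤x | shiftFrom-≥ i≤y = s≤s x<y
... | yes i≤x | no i≰y = ⊥-elim (i≰y (≤-trans i≤x (<⇒≤ x<y)))
... | no i≰x | yes i≤y rewrite shiftFrom-< (≰⇒> i≰x) | shiftFrom-≥ i≤y = m<n⇒m<1+n x<y
... | no i≰x | no i≰y rewrite shiftFrom-< (≰⇒> i≰x) | shiftFrom-< (≰⇒> i≰y) = x<y

shiftFrom-mono-≤ : ∀ i {x y} → x ≤ y → shiftFrom i x ≤ shiftFrom i y
shiftFrom-mono-≤ i x≤y with m≤n⇒m<n∨m≡n x≤y
... | inj₁ x<y = <⇒≤ (shiftFrom-mono-< i x<y)
... | inj₂ refl = ≤-refl

shiftFrom-cancel-< : ∀ i {x y} → shiftFrom i x < shiftFrom i y → x < y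
shiftFrom-cancel-< i {x} {y} sx<sy with x <? y
... | yes x<y = x<y
... | no x≮y = ⊥-elim (<⇒≱ sx<sy (shiftFrom-mono-≤ i (≮⇒≥ x≮y)))

shiftFrom-injective : ∀ i {x y} → shiftFrom i x ≡ shiftFrom i y → x ≡ y
shiftFrom-injective i {x} {y} eq with <-cmp x y
... | tri< x<y _ _ = ⊥-elim (<⇒≢ (shiftFrom-mono-< i x<y) eq)
... | tri≈ _ x≡y _ = x≡y
... | tri> _ _ y<x = ⊥-elim (<⇒≢ (shiftFrom-mono-< i y<x) (sym eq))

shiftFrom-≢ : ∀ i x → shiftFrom i x ≢ i
shiftFrom-≢ i x with i ≤? x
... | yes i≤x rewrite shiftFrom-≥ i≤x = >⇒≢ (s≤s i≤x)
... | no i≰x rewrite shiftFrom-< (≰⇒> i≰x) = <⇒≢ (≰⇒> i≰x)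

shiftFrom-suc : ∀ i x → shiftFrom (suc i) (suc x) ≡ suc (shiftFrom i x)
shiftFrom-suc zero x = refl
shiftFrom-suc (suc i) x with i <ᵇ x
... | true = refl
... | false = refl

unshiftFrom : ℕ → ℕ → ℕ
unshiftFrom i y = if i <ᵇ y then pred y else y

unshiftFrom-shiftFrom : ∀ i x → unshiftFrom i (shiftFrom i x) ≡ x
unshiftFrom-shiftFrom i x with i ≤? x
... | yes i≤x rewrite shiftFrom-≥ i≤x | <ᵇ-true (s≤s i≤x) = refl
... | no i≰x rewrite shiftFrom-< (≰⇒> i≰x) | <ᵇ-false {i} {x} (i≰x ∘ <⇒≤) = refl

shiftFrom-unshiftFrom : ∀ i y → y ≢ i → shiftFrom i (unshiftFrom i y) ≡ y
shiftFrom-unshiftFrom i y y≢i with i <? y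
shiftFrom-unshiftFrom i (suc y) _ | yes (s≤s i≤y) rewrite <ᵇ-true (s≤s i≤y) = shiftFrom-≥ i≤y
... | no i≮y rewrite <ᵇ-false i≮y = shiftFrom-< (≤∧≢⇒< (≮⇒≥ i≮y) y≢i)

unshiftFrom-suc : ∀ x → unshiftFrom x (suc x) ≡ x
unshiftFrom-suc x rewrite <ᵇ-true (n<1+n x) = refl

unshiftFrom-pred : ∀ y → unshiftFrom (suc y) y ≡ y
unshiftFrom-pred y rewrite <ᵇ-false {suc y} {y} (<-asym (n<1+n y)) = refl

unshiftFrom-shiftFrom-map : ∀ i l → map (unshiftFrom i) (map (shiftFrom i) l) ≡ l
unshiftFrom-shiftFrom-map i l =
  trans (sym (map-∘ l)) (trans (map-cong (unshiftFrom-shiftFrom i) l) (map-id l))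

shiftFrom-unshiftFrom-map : ∀ i l → i ∉ l → map (shiftFrom i) (map (unshiftFrom i) l) ≡ l
shiftFrom-unshiftFrom-map i [] _ = refl
shiftFrom-unshiftFrom-map i (y ∷ l) i∉ = cong₂ _∷_
  (shiftFrom-unshiftFrom i y (λ y≡i → i∉ (here (sym y≡i))))
  (shiftFrom-unshiftFrom-map i l (i∉ ∘ there))

map-shiftFrom-injective : ∀ i l l′ → map (shiftFrom i) l ≡ map (shiftFrom i) l′ → l ≡ l′
map-shiftFrom-injective i l l′ eq = trans (sym (unshiftFrom-shiftFrom-map i l))
  (trans (cong (map (unshiftFrom i)) eq) (unshiftFrom-shiftFrom-map i l′))

-- Counting recoils

addIf : Bool → ℕ → ℕ
addIf true n = suc n
addIf false n = n

addIf-suc : ∀ b n → addIf b (suc n) ≡ suc (addIf b n)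
addIf-suc true n = refl
addIf-suc false n = refl

addIf-comm : ∀ b c n → addIf b (addIf c n) ≡ addIf c (addIf b n)
addIf-comm true true n = refl
addIf-comm true false n = refl
addIf-comm false true n = refl
addIf-comm false false n = refl

countUpTo : (ℕ → Bool) → ℕ → ℕ
countUpTo Q n = countTrue (applyUpTo Q n)

countUpTo-suc : ∀ Q n → countUpTo Q (suc n) ≡ addIf (Q 0) (countUpTo (Q ∘ suc) n)
countUpTo-suc Q n with Q 0
... | true = refl
... | false = refl

countUpTo-cong : ∀ {Q Q′} n → (∀ u → Q u ≡ Q′ u) → countUpTo Q n ≡ countUpTo Q′ n
countUpTo-cong zero _ = refl
countUpTo-cong {Q} {Q′} (suc n) Q≗Q′ rewrite countUpTo-suc Q n | countUpTo-suc Q′ n | Q≗Q′ 0 =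
  cong (addIf (Q′ 0)) (countUpTo-cong n (Q≗Q′ ∘ suc))

countUpTo-falseHead : ∀ Qσ Qπ n → Qσ 0 ≡ false → (∀ u → Qσ (suc u) ≡ Qπ u) →
                      countUpTo Qσ n ≡ countUpTo Qπ (n ∸ 1)
countUpTo-falseHead Qσ Qπ zero _ _ = refl
countUpTo-falseHead Qσ Qπ (suc n) Qσ0 Qσ∘suc rewrite countUpTo-suc Qσ n | Qσ0 =
  countUpTo-cong n Qσ∘suc

-- Qσ arises from Qπ by replacing the entry c at index k (if any) with true, false.
countUpTo-splice : ∀ k Qσ Qπ n c → suc k ≤ n → (∀ u → u < k → Qσ u ≡ Qπ u) →
  Qσ k ≡ true → Qσ (suc k) ≡ false → (∀ u → Qσ (suc (suc k) + u) ≡ Qπ (suc k + u)) →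
  (suc k < n → Qπ k ≡ c) → (suc k ≡ n → c ≡ false) →
  addIf c (countUpTo Qσ n) ≡ suc (countUpTo Qπ (n ∸ 1))
countUpTo-splice zero Qσ Qπ (suc zero) c _ _ Qσk _ _ _ last
  rewrite countUpTo-suc Qσ 0 | Qσk | last refl = refl
countUpTo-splice zero Qσ Qπ (suc (suc n)) c _ _ Qσk Qσk+1 above inner _
  rewrite countUpTo-suc Qσ (suc n) | countUpTo-suc (Qσ ∘ suc) n | Qσk | Qσk+1
        | countUpTo-suc Qπ n | inner (s≤s (s≤s z≤n)) =
  trans (addIf-suc c _) (cong (suc ∘ addIf c) (countUpTo-cong n above))
countUpTo-splice (suc k) Qσ Qπ (suc zero) c (s≤s ()) _ _ _ _ _ _
countUpTo-splice (suc k) Qσ Qπ (suc (suc n)) c (s≤s k<n) below Qσk Qσk+1 above inner last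
  rewrite countUpTo-suc Qσ (suc n) | countUpTo-suc Qπ n | below 0 z<s =
  begin
    addIf c (addIf (Qπ 0) (countUpTo (Qσ ∘ suc) (suc n)))
  ≡⟨ addIf-comm c (Qπ 0) _ ⟩
    addIf (Qπ 0) (addIf c (countUpTo (Qσ ∘ suc) (suc n)))
  ≡⟨ cong (addIf (Qπ 0)) (countUpTo-splice k (Qσ ∘ suc) (Qπ ∘ suc) (suc n) c k<n
        (λ u u<k → below (suc u) (s≤s u<k)) Qσk Qσk+1 above (inner ∘ s≤s) (last ∘ cong suc)) ⟩
    addIf (Qπ 0) (suc (countUpTo (Qπ ∘ suc) n))
  ≡⟨ addIf-suc (Qπ 0) _ ⟩
    suc (addIf (Qπ 0) (countUpTo (Qπ ∘ suc) n))
  ∎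
  where open ≡-Reasoning

recoilAt : Perm → ℕ → Bool
recoilAt π v = posOf (suc v) π <ᵇ posOf v π

recoils-countUpTo : ∀ π → recoils π ≡ countUpTo (recoilAt π ∘ suc) (length π ∸ 1)
recoils-countUpTo π = cong countTrue (trans (sym (map-∘ (upTo (length π ∸ 1)))) (map-upTo _ _))

posOf-head : ∀ x l → posOf x (x ∷ l) ≡ 0
posOf-head x l rewrite ≡ᵇ-true {x} refl = refl

posOf-there : ∀ {x y} l → x ≢ y → posOf x (y ∷ l) ≡ suc (posOf x l)
posOf-there l x≢y rewrite ≡ᵇ-false x≢y = refl

posOf-map-shiftFrom : ∀ i x π → posOf (shiftFrom i x) (map (shiftFrom i) π) ≡ posOf x π
posOf-map-shiftFrom i x [] = refl
posOf-map-shiftFrom i x (y ∷ π) with x ≟ y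
... | yes refl rewrite posOf-head (shiftFrom i x) (map (shiftFrom i) π) | posOf-head x π = refl
... | no x≢y rewrite posOf-there (map (shiftFrom i) π) (x≢y ∘ shiftFrom-injective i)
                   | posOf-there π x≢y = cong suc (posOf-map-shiftFrom i x π)

posOf-ρ-front : ∀ i x π → posOf (shiftFrom i x) (ρ i 1 π) ≡ suc (posOf x π)
posOf-ρ-front i x π rewrite posOf-there (map (shiftFrom i) π) (shiftFrom-≢ i x) =
  cong suc (posOf-map-shiftFrom i x π)

posOf-ρ-front-new : ∀ i π → posOf i (ρ i 1 π) ≡ 0
posOf-ρ-front-new i π = posOf-head i (map (shiftFrom i) π)

recoilAt-ρ-front-below : ∀ i π v → suc v < i → recoilAt (ρ i 1 π) v ≡ recoilAt π v
recoilAt-ρ-front-below i π v v+1<i = cong₂ _<ᵇ_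
  (trans (cong (λ z → posOf z (ρ i 1 π)) (sym (shiftFrom-< v+1<i))) (posOf-ρ-front i (suc v) π))
  (trans (cong (λ z → posOf z (ρ i 1 π)) (sym (shiftFrom-< {i} {v} (<-trans (n<1+n v) v+1<i))))
         (posOf-ρ-front i v π))

recoilAt-ρ-front-above : ∀ i π w → i ≤ w → recoilAt (ρ i 1 π) (suc w) ≡ recoilAt π w
recoilAt-ρ-front-above i π w i≤w = cong₂ _<ᵇ_
  (trans (cong (λ z → posOf z (ρ i 1 π)) (sym (shiftFrom-≥ {i} {suc w} (m≤n⇒m≤1+n i≤w))))
         (posOf-ρ-front i (suc w) π))
  (trans (cong (λ z → posOf z (ρ i 1 π)) (sym (shiftFrom-≥ i≤w))) (posOf-ρ-front i w π))

recoilAt-ρ-front-pred : ∀ k π → recoilAt (ρ (suc k) 1 π) k ≡ true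
recoilAt-ρ-front-pred k π
  rewrite posOf-ρ-front-new (suc k) π
        | posOf-there {k} {suc k} (map (shiftFrom (suc k)) π) (<⇒≢ (n<1+n k)) = refl

recoilAt-ρ-front-new : ∀ i π → recoilAt (ρ i 1 π) i ≡ false
recoilAt-ρ-front-new i π rewrite posOf-ρ-front-new i π = refl

length-ρ-front : ∀ i π → length (ρ i 1 π) ∸ 1 ≡ length π
length-ρ-front i π = length-map (shiftFrom i) π

-- Putting k+2 in front creates the recoil k+1; the only recoil of π that can be lost is k+1, recorded by c.
recoils-ρ-front : ∀ k π → suc k ≤ length π → (c : Bool) →
  (suc k < length π → recoilAt π (suc k) ≡ c) → (suc k ≡ length π → c ≡ false) →
  addIf c (recoils (ρ (suc (suc k)) 1 π)) ≡ suc (recoils π)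
recoils-ρ-front k π k<len c inner last
  rewrite recoils-countUpTo (ρ (suc (suc k)) 1 π) | recoils-countUpTo π
        | length-ρ-front (suc (suc k)) π =
  countUpTo-splice k (recoilAt σ ∘ suc) (recoilAt π ∘ suc) (length π) c k<len
    (λ u u<k → recoilAt-ρ-front-below (suc (suc k)) π (suc u) (s≤s (s≤s u<k)))
    (recoilAt-ρ-front-pred (suc k) π) (recoilAt-ρ-front-new (suc (suc k)) π)
    (λ u → recoilAt-ρ-front-above (suc (suc k)) π (suc (suc k) + u) (m≤m+n (suc (suc k)) u))
    inner last
  where σ = ρ (suc (suc k)) 1 π

recoils-ψ₁ : ∀ π → recoils (ψ L1 π) ≡ recoils π
recoils-ψ₁ π rewrite recoils-countUpTo (ρ 1 1 π) | recoils-countUpTo π | length-ρ-front 1 π =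
  countUpTo-falseHead (recoilAt (ρ 1 1 π) ∘ suc) (recoilAt π ∘ suc) (length π)
    (recoilAt-ρ-front-new 1 π) (λ u → recoilAt-ρ-front-above 1 π (suc u) z<s)

-- Position of an old entry after inserting a new entry at index 1.
skipIndex1 : ℕ → ℕ
skipIndex1 zero = zero
skipIndex1 (suc p) = suc (suc p)

skipIndex1-<ᵇ : ∀ p q → (skipIndex1 p <ᵇ skipIndex1 q) ≡ (p <ᵇ q)
skipIndex1-<ᵇ zero zero = refl
skipIndex1-<ᵇ zero (suc q) = refl
skipIndex1-<ᵇ (suc p) zero = refl
skipIndex1-<ᵇ (suc p) (suc q) = refl

posOf-ψ₂ : ∀ c rest x → posOf (shiftFrom 1 x) (ψ L2 (c ∷ rest)) ≡ skipIndex1 (posOf x (c ∷ rest))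
posOf-ψ₂ c rest x with x ≟ c
... | yes refl rewrite posOf-head (shiftFrom 1 x) (1 ∷ map (shiftFrom 1) rest) | posOf-head x rest = refl
... | no x≢c
  rewrite posOf-there {shiftFrom 1 x} {shiftFrom 1 c} (1 ∷ map (shiftFrom 1) rest) (x≢c ∘ shiftFrom-injective 1)
        | posOf-there {shiftFrom 1 x} {1} (map (shiftFrom 1) rest) (shiftFrom-≢ 1 x)
        | posOf-there {x} {c} rest x≢c = cong (suc ∘ suc) (posOf-map-shiftFrom 1 x rest)

recoils-ψ₂ : ∀ c rest → c ≢ 1 → recoils (ψ L2 (c ∷ rest)) ≡ recoils (c ∷ rest)
recoils-ψ₂ c rest c≢1
  rewrite recoils-countUpTo (ψ L2 (c ∷ rest)) | recoils-countUpTo (c ∷ rest) | length-map (shiftFrom 1) rest =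
  countUpTo-falseHead (recoilAt σ ∘ suc) (recoilAt (c ∷ rest) ∘ suc) (suc (length rest)) no-recoil-1
    (λ u → trans (cong₂ _<ᵇ_ (posOf-ψ₂ c rest (suc (suc u))) (posOf-ψ₂ c rest (suc u)))
                 (skipIndex1-<ᵇ (posOf (suc (suc u)) (c ∷ rest)) (posOf (suc u) (c ∷ rest))))
  where
  σ = ψ L2 (c ∷ rest)
  posOf-1 : posOf 1 σ ≡ 1
  posOf-1 rewrite posOf-there {1} {shiftFrom 1 c} (1 ∷ map (shiftFrom 1) rest) (shiftFrom-≢ 1 c ∘ sym)
                | posOf-head 1 (map (shiftFrom 1) rest) = refl
  no-recoil-1 : recoilAt σ 1 ≡ false
  no-recoil-1 rewrite posOf-1 | posOf-ψ₂ c rest 1 | posOf-there {1} {c} rest (c≢1 ∘ sym) = refl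

recoils-ψu : ∀ k rest → suc (suc k) ≤ length (suc (suc k) ∷ rest) →
             recoils (ψ Lu (suc (suc k) ∷ rest)) ≡ recoils (suc (suc k) ∷ rest)
recoils-ψu k rest k+2≤len =
  suc-injective (recoils-ρ-front k π (≤-trans (n≤1+n (suc k)) k+2≤len) true inner last)
  where
  π = suc (suc k) ∷ rest
  inner : suc k < length π → recoilAt π (suc k) ≡ true
  inner _ rewrite posOf-head (suc (suc k)) rest
                | posOf-there {suc k} {suc (suc k)} rest (<⇒≢ (n<1+n (suc k))) = refl
  last : suc k ≡ length π → true ≡ false
  last k+1≡len = ⊥-elim (<⇒≢ k+2≤len k+1≡len)

recoils-ψd : ∀ k rest → suc k ≤ length (suc k ∷ rest) →
             recoils (ψ Ld (suc k ∷ rest)) ≡ suc (recoils (suc k ∷ rest))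
recoils-ψd k rest k+1≤len = recoils-ρ-front k π k+1≤len false inner (λ _ → refl)
  where
  π = suc k ∷ rest
  inner : suc k < length π → recoilAt π (suc k) ≡ false
  inner _ rewrite posOf-head (suc k) rest = refl

oneTo-suc : ∀ n → oneTo (suc n) ≡ 1 ∷ map suc (oneTo n)
oneTo-suc n = cong (λ l → 1 ∷ map suc l) (sym (map-upTo suc n))

shiftFrom-1-map-suc : ∀ l → map (shiftFrom 1) (map suc l) ≡ map suc (map suc l)
shiftFrom-1-map-suc [] = refl
shiftFrom-1-map-suc (x ∷ l) = cong (suc (suc x) ∷_) (shiftFrom-1-map-suc l)

shiftFrom-suc-map-suc : ∀ i l → map (shiftFrom (suc i)) (map suc l) ≡ map suc (map (shiftFrom i) l)
shiftFrom-suc-map-suc i [] = refl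
shiftFrom-suc-map-suc i (x ∷ l) = cong₂ _∷_ (shiftFrom-suc i x) (shiftFrom-suc-map-suc i l)

insert-oneTo : ∀ i n → 1 ≤ i → i ≤ suc n → i ∷ map (shiftFrom i) (oneTo n) ↭ oneTo (suc n)
insert-oneTo (suc zero) n _ _ = begin
  1 ∷ map (shiftFrom 1) (map suc (upTo n))  ≡⟨ cong (1 ∷_) (shiftFrom-1-map-suc (upTo n)) ⟩
  1 ∷ map suc (oneTo n)                      ≡⟨ sym (oneTo-suc n) ⟩
  oneTo (suc n)                              ∎
  where open PermutationReasoning
insert-oneTo (suc (suc i)) zero _ (s≤s ())
insert-oneTo (suc (suc i)) (suc n) _ (s≤s i+1≤n+1) = begin
  suc (suc i) ∷ map (shiftFrom (suc (suc i))) (oneTo (suc n))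
    ≡⟨ cong (λ l → suc (suc i) ∷ map (shiftFrom (suc (suc i))) l) (oneTo-suc n) ⟩
  suc (suc i) ∷ 1 ∷ map (shiftFrom (suc (suc i))) (map suc (oneTo n))
    ≡⟨ cong (λ l → suc (suc i) ∷ 1 ∷ l) (shiftFrom-suc-map-suc (suc i) (oneTo n)) ⟩
  suc (suc i) ∷ 1 ∷ map suc (map (shiftFrom (suc i)) (oneTo n))
    ↭⟨ swap _ _ ↭-refl ⟩
  1 ∷ map suc (suc i ∷ map (shiftFrom (suc i)) (oneTo n))
    ↭⟨ prep 1 (↭-map⁺ suc (insert-oneTo (suc i) n z<s i+1≤n+1)) ⟩
  1 ∷ map suc (oneTo (suc n))
    ≡⟨ sym (oneTo-suc (suc n)) ⟩
  oneTo (suc (suc n)) ∎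
  where open PermutationReasoning

ρ-↭-front : ∀ i j π → ρ i j π ↭ i ∷ map (shiftFrom i) π
ρ-↭-front i j π = subst (λ l → ρ i j π ↭ i ∷ l) (take++drop≡id (j ∸ 1) π′)
                        (shift i (take (j ∸ 1) π′) (drop (j ∸ 1) π′))
  where π′ = map (shiftFrom i) π

ρ-IsPerm : ∀ {n π} i j → 1 ≤ i → i ≤ suc n → IsPerm n π → IsPerm (suc n) (ρ i j π)
ρ-IsPerm {n} {π} i j 1≤i i≤n+1 π↭ =
  ↭-trans (ρ-↭-front i j π) (↭-trans (prep i (↭-map⁺ (shiftFrom i) π↭)) (insert-oneTo i n 1≤i i≤n+1))

ρ-IsPerm⁻ : ∀ {n π} i j → 1 ≤ i → i ≤ suc n → IsPerm (suc n) (ρ i j π) → IsPerm n π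
ρ-IsPerm⁻ {n} {π} i j 1≤i i≤n+1 ρ↭ =
  subst₂ _↭_ (unshiftFrom-shiftFrom-map i π) (unshiftFrom-shiftFrom-map i (oneTo n))
    (↭-map⁺ (unshiftFrom i)
      (drop-∷ (↭-trans (↭-sym (ρ-↭-front i j π)) (↭-trans ρ↭ (↭-sym (insert-oneTo i n 1≤i i≤n+1))))))

∈-oneTo⁻ : ∀ {x n} → x ∈ oneTo n → 1 ≤ x × x ≤ n
∈-oneTo⁻ x∈ with ∈-map⁻ suc x∈
... | _ , y∈ , refl = s≤s z≤n , ∈-upTo⁻ y∈

IsPerm-∈⁻ : ∀ {x n π} → IsPerm n π → x ∈ π → 1 ≤ x × x ≤ n
IsPerm-∈⁻ π↭ x∈ = ∈-oneTo⁻ (∈-resp-↭ π↭ x∈)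

IsPerm-∈⁺ : ∀ {x n π} → IsPerm n π → 1 ≤ x → x ≤ n → x ∈ π
IsPerm-∈⁺ {suc x} π↭ _ x<n = ∈-resp-↭ (↭-sym π↭) (∈-map⁺ suc (∈-upTo⁺ x<n))

IsPerm-length : ∀ {n π} → IsPerm n π → length π ≡ n
IsPerm-length {n} π↭ = trans (↭-length π↭) (trans (length-map suc (upTo n)) (length-upTo n))

IsPerm-Unique : ∀ {n π} → IsPerm n π → Unique π
IsPerm-Unique {n} π↭ = Unique-resp-↭ (↭⇒↭ₛ (↭-sym π↭)) (Unique-map⁺ suc-injective (upTo⁺ n))

IsPerm-head∉ : ∀ {n y rest} → IsPerm n (y ∷ rest) → y ∉ rest
IsPerm-head∉ π↭ with IsPerm-Unique π↭
... | y≢ ∷ _ = All¬⇒¬Any y≢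

-- Pattern containment

at-∈ : ∀ (s : List ℕ) i → i < length s → at s i ∈ s
at-∈ (x ∷ s) zero _ = here refl
at-∈ (x ∷ s) (suc i) (s≤s i<len) = there (at-∈ s i i<len)

at-map : ∀ f (s : List ℕ) i → i < length s → at (map f s) i ≡ f (at s i)
at-map f (x ∷ s) zero _ = refl
at-map f (x ∷ s) (suc i) (s≤s i<len) = at-map f s i i<len

OrderPreservingOn : (ℕ → ℕ) → List ℕ → Set
OrderPreservingOn f s = ∀ u v → u ∈ s → v ∈ s → (u < v ⇔ f u < f v)

shiftFrom-OrderPreservingOn : ∀ i s → OrderPreservingOn (shiftFrom i) s
shiftFrom-OrderPreservingOn i s u v _ _ = mk⇔ (shiftFrom-mono-< i) (shiftFrom-cancel-< i)

<-⇔-cong : ∀ {a a′ b b′} → a ≡ a′ → b ≡ b′ → (a < b) ⇔ (a′ < b′)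
<-⇔-cong refl refl = ⇔-refl

OrderIso-map⁺ : ∀ f s p → OrderPreservingOn f s → OrderIso s p → OrderIso (map f s) p
OrderIso-map⁺ f s p f-pres (len≡ , iso) = trans (length-map f s) len≡ , λ i j i< j< →
  let i<′ = subst (i <_) (length-map f s) i<
      j<′ = subst (j <_) (length-map f s) j<
  in ⇔-trans (<-⇔-cong (at-map f s i i<′) (at-map f s j j<′))
     (⇔-trans (⇔-sym (f-pres _ _ (at-∈ s i i<′) (at-∈ s j j<′))) (iso i j i<′ j<′))

OrderIso-map⁻ : ∀ f s p → OrderPreservingOn f s → OrderIso (map f s) p → OrderIso s p
OrderIso-map⁻ f s p f-pres (len≡ , iso) = trans (sym (length-map f s)) len≡ , λ i j i< j< →
  let i<′ = subst (i <_) (sym (length-map f s)) i<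
      j<′ = subst (j <_) (sym (length-map f s)) j<
  in ⇔-trans (f-pres _ _ (at-∈ s i i<) (at-∈ s j j<))
     (⇔-trans (<-⇔-cong (sym (at-map f s i i<)) (sym (at-map f s j j<))) (iso i j i<′ j<′))

⊆-map⁻ʳ : ∀ f {s : List ℕ} π → s ⊆ map f π → Σ[ s₀ ∈ List ℕ ] (s₀ ⊆ π × s ≡ map f s₀)
⊆-map⁻ʳ f [] [] = [] , [] , refl
⊆-map⁻ʳ f (y ∷ π) (_ ∷ʳ s⊆) with ⊆-map⁻ʳ f π s⊆
... | s₀ , s₀⊆ , refl = s₀ , y ∷ʳ s₀⊆ , refl
⊆-map⁻ʳ f (y ∷ π) (refl ∷ s⊆) with ⊆-map⁻ʳ f π s⊆
... | s₀ , s₀⊆ , refl = y ∷ s₀ , refl ∷ s₀⊆ , refl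

Contains-map-shiftFrom⁻ : ∀ i π p → Contains (map (shiftFrom i) π) p → Contains π p
Contains-map-shiftFrom⁻ i π p (s , s⊆ , iso) with ⊆-map⁻ʳ (shiftFrom i) π s⊆
... | s₀ , s₀⊆ , refl = s₀ , s₀⊆ , OrderIso-map⁻ (shiftFrom i) s₀ p (shiftFrom-OrderPreservingOn i s₀) iso

⊆-insert : ∀ k (l : List ℕ) x → l ⊆ take k l ++ x ∷ drop k l
⊆-insert zero l x = x ∷ʳ ⊆-refl
⊆-insert (suc k) [] x = x ∷ʳ []
⊆-insert (suc k) (y ∷ l) x = refl ∷ ⊆-insert k l x

Contains-ρ : ∀ i j π p → Contains π p → Contains (ρ i j π) p
Contains-ρ i j π p (s , s⊆ , iso) =
  map (shiftFrom i) s ,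
  ⊆-trans (⊆-map⁺ (shiftFrom i) s⊆) (⊆-insert (j ∸ 1) (map (shiftFrom i) π) i) ,
  OrderIso-map⁺ (shiftFrom i) s p (shiftFrom-OrderPreservingOn i s) iso

-- Each forbidden pattern has an entry below its first two entries and an entry strictly between them;
-- this is all that is used about them when showing that the ψ maps preserve rectangularity.
record ForbiddenShape (p : Perm) : Set where
  constructor forbiddenShape
  field
    length≡4 : length p ≡ 4
    below : ℕ
    below<4 : below < 4
    below<first : at p below < at p 0
    below<second : at p below < at p 1
    between : ℕ
    between<4 : between < 4
    isBetween : (at p 0 < at p between × at p between < at p 1)
              ⊎ (at p 1 < at p between × at p between < at p 0)

<-compute : ∀ m n → {T (m <ᵇ n)} → m < n
<-compute m n {m<ᵇn} = <ᵇ⇒< m n m<ᵇn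

shape-2413 : ForbiddenShape (2 ∷ 4 ∷ 1 ∷ 3 ∷ [])
shape-2413 = forbiddenShape refl
  2 (<-compute 2 4) (<-compute 1 2) (<-compute 1 4) 3 (<-compute 3 4) (inj₁ (<-compute 2 3 , <-compute 3 4))

shape-2431 : ForbiddenShape (2 ∷ 4 ∷ 3 ∷ 1 ∷ [])
shape-2431 = forbiddenShape refl
  3 (<-compute 3 4) (<-compute 1 2) (<-compute 1 4) 2 (<-compute 2 4) (inj₁ (<-compute 2 3 , <-compute 3 4))

shape-4213 : ForbiddenShape (4 ∷ 2 ∷ 1 ∷ 3 ∷ [])
shape-4213 = forbiddenShape refl
  2 (<-compute 2 4) (<-compute 1 4) (<-compute 1 2) 3 (<-compute 3 4) (inj₂ (<-compute 2 3 , <-compute 3 4))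

shape-4231 : ForbiddenShape (4 ∷ 2 ∷ 3 ∷ 1 ∷ [])
shape-4231 = forbiddenShape refl
  3 (<-compute 3 4) (<-compute 1 4) (<-compute 1 2) 2 (<-compute 2 4) (inj₂ (<-compute 2 3 , <-compute 3 4))

Rectangular-lift : ∀ {π σ} → (∀ p → ForbiddenShape p → Avoids π p → Avoids σ p) →
                   Rectangular π → Rectangular σ
Rectangular-lift lift (a₁ , a₂ , a₃ , a₄) =
  lift _ shape-2413 a₁ , lift _ shape-2431 a₂ , lift _ shape-4213 a₃ , lift _ shape-4231 a₄

Rectangular-lower : ∀ {π σ} → (∀ p → Contains π p → Contains σ p) → Rectangular σ → Rectangular π
Rectangular-lower lift (a₁ , a₂ , a₃ , a₄) = a₁ ∘ lift _ , a₂ ∘ lift _ , a₃ ∘ lift _ , a₄ ∘ lift _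

SameOrder : ℕ → ℕ → ℕ → Set
SameOrder h h′ z = (h < z ⇔ h′ < z) × (z < h ⇔ z < h′)

adjacent-SameOrder : ∀ {h h′ z} → (h′ ≡ suc h ⊎ h ≡ suc h′) → z ≢ h → z ≢ h′ → SameOrder h h′ z
adjacent-SameOrder {h} (inj₁ refl) z≢h z≢h+1 =
  mk⇔ (λ h<z → ≤∧≢⇒< h<z (z≢h+1 ∘ sym)) (<-trans (n<1+n h)) ,
  mk⇔ m<n⇒m<1+n (λ z<h+1 → ≤∧≢⇒< (≤-pred z<h+1) z≢h)
adjacent-SameOrder (inj₂ refl) z≢h z≢h′ with adjacent-SameOrder (inj₁ refl) z≢h′ z≢h
... | above , below = ⇔-sym above , ⇔-sym below

OrderIso-replaceHead : ∀ h h′ t p → (∀ z → z ∈ t → SameOrder h h′ z) →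
                       OrderIso (h ∷ t) p → OrderIso (h′ ∷ t) p
OrderIso-replaceHead h h′ t p same (len≡ , iso) = len≡ , iso′
  where
  iso′ : ∀ i j → i < length (h′ ∷ t) → j < length (h′ ∷ t) →
         (at (h′ ∷ t) i < at (h′ ∷ t) j) ⇔ (at p i < at p j)
  iso′ zero zero i< j< = ⇔-trans (mk⇔ (⊥-elim ∘ <-irrefl refl) (⊥-elim ∘ <-irrefl refl)) (iso 0 0 i< j<)
  iso′ zero (suc j) i< j< = ⇔-trans (⇔-sym (proj₁ (same _ (at-∈ t j (≤-pred j<))))) (iso 0 (suc j) i< j<)
  iso′ (suc i) zero i< j< = ⇔-trans (⇔-sym (proj₂ (same _ (at-∈ t i (≤-pred i<))))) (iso (suc i) 0 i< j<)
  iso′ (suc i) (suc j) i< j< = iso (suc i) (suc j) i< j<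

⊆-IsPerm-positive : ∀ {n σ s} → IsPerm n σ → s ⊆ σ → ∀ x → x ∈ s → 1 ≤ x
⊆-IsPerm-positive σ↭ s⊆ x x∈ = proj₁ (IsPerm-∈⁻ σ↭ (lookup s⊆ x∈))

module _ {p : Perm} (shape : ForbiddenShape p) where
  open ForbiddenShape shape

  <length : ∀ s → OrderIso s p → ∀ {m} → m < 4 → m < length s
  <length s (len≡ , _) = subst (_ <_) (sym (trans len≡ length≡4))

  reflect-< : ∀ s → OrderIso s p → ∀ {i j} → i < 4 → j < 4 → at p i < at p j → at s i < at s j
  reflect-< s s≅p {i} {j} i<4 j<4 = Equivalence.from (proj₂ s≅p i j (<length s s≅p i<4) (<length s s≅p j<4))

  below<leading : ∀ m → m < 2 → at p below < at p m
  below<leading zero _ = below<first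
  below<leading (suc zero) _ = below<second
  below<leading (suc (suc _)) (s≤s (s≤s ()))

  forbidden-leading-min : ∀ {s m} → OrderIso s p → m < 2 → (∀ x → x ∈ s → 1 ≤ x) → at s m ≡ 1 → ⊥
  forbidden-leading-min {s} {m} s≅p m<2 positive sₘ≡1 =
    <-irrefl refl (<-≤-trans sᵦ<1 (positive _ (at-∈ s below (<length s s≅p below<4))))
    where
    sᵦ<1 : at s below < 1
    sᵦ<1 = subst (at s below <_) sₘ≡1
      (reflect-< s s≅p below<4 (<-trans m<2 (<-compute 2 4)) (below<leading m m<2))

  forbidden-leading-adjacent : ∀ {h h′ s} → OrderIso (h ∷ h′ ∷ s) p → (h′ ≡ suc h ⊎ h ≡ suc h′) → ⊥
  forbidden-leading-adjacent {h} {h′} {s} s≅p adjacent = [ increasing , decreasing ] isBetween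
    where
    reflect = reflect-< (h ∷ h′ ∷ s) s≅p
    noneBetween : ∀ {a x b} → a < x → x < b → (b ≡ suc a ⊎ a ≡ suc b) → ⊥
    noneBetween a<x x<b (inj₁ refl) = <-irrefl refl (<-≤-trans a<x (≤-pred x<b))
    noneBetween a<x x<b (inj₂ refl) = <-irrefl refl (<-trans (<-trans a<x x<b) (n<1+n _))
    increasing : at p 0 < at p between × at p between < at p 1 → ⊥
    increasing (a , b) =
      noneBetween (reflect (<-compute 0 4) between<4 a) (reflect between<4 (<-compute 1 4) b) adjacent
    decreasing : at p 1 < at p between × at p between < at p 0 → ⊥
    decreasing (a , b) =
      noneBetween (reflect (<-compute 1 4) between<4 a) (reflect between<4 (<-compute 0 4) b) (⊎-swap adjacent)

  -- An occurrence in ρ i j π that does not use the new entry i is an occurrence in π.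
  Avoids-ψ₁ : ∀ {n π} → IsPerm n π → Avoids π p → Avoids (ψ L1 π) p
  Avoids-ψ₁ {π = π} _ avoids (s , _ ∷ʳ s⊆ , s≅p) = avoids (Contains-map-shiftFrom⁻ 1 π p (s , s⊆ , s≅p))
  Avoids-ψ₁ π↭ _ (1 ∷ s , refl ∷ s⊆ , s≅p) =
    forbidden-leading-min s≅p z<s (⊆-IsPerm-positive (ρ-IsPerm 1 1 z<s z<s π↭) (refl ∷ s⊆)) refl

  Avoids-ψ₂ : ∀ {n c rest} → IsPerm n (c ∷ rest) → Avoids (c ∷ rest) p → Avoids (ψ L2 (c ∷ rest)) p
  Avoids-ψ₂ {c = c} {rest} _ avoids (s , _ ∷ʳ (_ ∷ʳ s⊆) , s≅p) =
    avoids (Contains-map-shiftFrom⁻ 1 (c ∷ rest) p (s , shiftFrom 1 c ∷ʳ s⊆ , s≅p))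
  Avoids-ψ₂ {c = c} {rest} _ avoids (_ ∷ s , refl ∷ (_ ∷ʳ s⊆) , s≅p) =
    avoids (Contains-map-shiftFrom⁻ 1 (c ∷ rest) p (shiftFrom 1 c ∷ s , refl ∷ s⊆ , s≅p))
  Avoids-ψ₂ σ↭ _ (_ ∷ s , _ ∷ʳ (refl ∷ s⊆) , s≅p) =
    forbidden-leading-min s≅p z<s
      (⊆-IsPerm-positive (ρ-IsPerm 1 2 z<s z<s σ↭) (_ ∷ʳ (refl ∷ s⊆))) refl
  Avoids-ψ₂ σ↭ _ (_ ∷ _ ∷ s , refl ∷ (refl ∷ s⊆) , s≅p) =
    forbidden-leading-min s≅p (s≤s z<s)
      (⊆-IsPerm-positive (ρ-IsPerm 1 2 z<s z<s σ↭) (refl ∷ (refl ∷ s⊆))) refl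

  Avoids-ρ-front-adjacent : ∀ {n y rest} i → IsPerm n (y ∷ rest) →
    (shiftFrom i y ≡ suc i ⊎ i ≡ suc (shiftFrom i y)) → Avoids (y ∷ rest) p → Avoids (ρ i 1 (y ∷ rest)) p
  Avoids-ρ-front-adjacent {y = y} {rest} i _ _ avoids (s , _ ∷ʳ s⊆ , s≅p) =
    avoids (Contains-map-shiftFrom⁻ i (y ∷ rest) p (s , s⊆ , s≅p))
  Avoids-ρ-front-adjacent i _ adjacent _ (_ ∷ _ ∷ s , refl ∷ (refl ∷ s⊆) , s≅p) =
    forbidden-leading-adjacent s≅p adjacent
  Avoids-ρ-front-adjacent {y = y} {rest} i σ↭ adjacent avoids (_ ∷ s , refl ∷ (_ ∷ʳ s⊆) , s≅p) =
    avoids (Contains-map-shiftFrom⁻ i (y ∷ rest) p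
      (shiftFrom i y ∷ s , refl ∷ s⊆ , OrderIso-replaceHead i (shiftFrom i y) s p same s≅p))
    where
    same : ∀ z → z ∈ s → SameOrder i (shiftFrom i y) z
    same z z∈ with ∈-map⁻ (shiftFrom i) (lookup s⊆ z∈)
    ... | x , x∈ , refl = adjacent-SameOrder adjacent (shiftFrom-≢ i x)
                            (λ e → IsPerm-head∉ σ↭ (subst (_∈ rest) (shiftFrom-injective i e) x∈))

-- Soundness

RectPerm : ℕ → Perm → Set
RectPerm n π = IsPerm n π × Rectangular π

Rectangular-[] : Rectangular []
Rectangular-[] = avoids , avoids , avoids , avoids
  where
  avoids : ∀ {x p} → Avoids [] (x ∷ p)
  avoids (.[] , [] , ())

IsPerm-head-positive : ∀ {n x rest} → IsPerm n (x ∷ rest) → 1 ≤ x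
IsPerm-head-positive π↭ = proj₁ (IsPerm-∈⁻ π↭ (here refl))

¬IsPerm-0∷ : ∀ {n rest} → ¬ IsPerm n (0 ∷ rest)
¬IsPerm-0∷ π↭ = <-irrefl refl (IsPerm-head-positive π↭)

IsPerm-head-≤ : ∀ {n x rest} → IsPerm n (x ∷ rest) → x ≤ n
IsPerm-head-≤ π↭ = proj₂ (IsPerm-∈⁻ π↭ (here refl))

RecoilStep : Letter → Perm → Set
RecoilStep Ld π = recoils (ψ Ld π) ≡ suc (recoils π)
RecoilStep l π = recoils (ψ l π) ≡ recoils π

ψ-sound : ∀ l {n} π → RectPerm n π → InDomain l π → RectPerm (suc n) (ψ l π) × RecoilStep l π
ψ-sound L1 π (π↭ , rect) _ =
  (ρ-IsPerm 1 1 z<s z<s π↭ , Rectangular-lift (λ p shape → Avoids-ψ₁ shape π↭) rect) , recoils-ψ₁ π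
ψ-sound L2 (c ∷ rest) (π↭ , rect) (_ , _ , c≢1) =
  (ρ-IsPerm 1 2 z<s z<s π↭ , Rectangular-lift (λ p shape → Avoids-ψ₂ shape π↭) rect) ,
  recoils-ψ₂ c rest c≢1
ψ-sound Lu (zero ∷ rest) (π↭ , _) _ = ⊥-elim (¬IsPerm-0∷ π↭)
ψ-sound Lu (suc zero ∷ rest) _ (_ , _ , c≢1) = ⊥-elim (c≢1 refl)
ψ-sound Lu (suc (suc k) ∷ rest) (π↭ , rect) _ =
  (ρ-IsPerm (suc (suc k)) 1 z<s (m≤n⇒m≤1+n (IsPerm-head-≤ π↭)) π↭ ,
   Rectangular-lift (λ p shape → Avoids-ρ-front-adjacent shape _ π↭ (inj₁ (shiftFrom-≥ ≤-refl))) rect) ,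
  recoils-ψu k rest (subst (suc (suc k) ≤_) (sym (IsPerm-length π↭)) (IsPerm-head-≤ π↭))
ψ-sound Ld (zero ∷ rest) (π↭ , _) _ = ⊥-elim (¬IsPerm-0∷ π↭)
ψ-sound Ld (suc k ∷ rest) (π↭ , rect) _ =
  (ρ-IsPerm (suc (suc k)) 1 z<s (s≤s (IsPerm-head-≤ π↭)) π↭ ,
   Rectangular-lift (λ p shape → Avoids-ρ-front-adjacent shape _ π↭
                                   (inj₂ (cong suc (sym (shiftFrom-< {suc (suc k)} {suc k} ≤-refl))))) rect) ,
  recoils-ψd k rest (subst (suc k ≤_) (sym (IsPerm-length π↭)) (IsPerm-head-≤ π↭))

eval-sound : ∀ w → Valid w → RectPerm (length w) (eval w) × recoils (eval w) ≡ countD w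
eval-sound [] _ = (↭-refl , Rectangular-[]) , refl
eval-sound (l ∷ w) (valid , inDomain) with eval-sound w valid
... | rectPerm , recoils≡ with ψ-sound l (eval w) rectPerm inDomain
... | rectPerm′ , step = rectPerm′ , recoils-step l step
  where
  recoils-step : ∀ l → RecoilStep l (eval w) → recoils (ψ l (eval w)) ≡ countD (l ∷ w)
  recoils-step L1 step = trans step recoils≡
  recoils-step L2 step = trans step recoils≡
  recoils-step Lu step = trans step recoils≡
  recoils-step Ld step = trans step (cong suc recoils≡)

-- Injectivity

-- The letter applied last can be read off the first two entries.
lastLetter : Perm → Letter
lastLetter (x ∷ y ∷ _) = if x ≡ᵇ 1 then L1 else (if y ≡ᵇ suc x then Lu else (if x ≡ᵇ suc y then Ld else L2))
lastLetter _ = L1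

lastLetter-ψ : ∀ l {n} π → RectPerm n π → InDomain l π → lastLetter (ψ l π) ≡ l
lastLetter-ψ L1 [] _ _ = refl
lastLetter-ψ L1 (x ∷ π) _ _ = refl
lastLetter-ψ L2 (zero ∷ rest) (π↭ , _) _ = ⊥-elim (¬IsPerm-0∷ π↭)
lastLetter-ψ L2 (suc zero ∷ rest) _ (_ , _ , c≢1) = ⊥-elim (c≢1 refl)
lastLetter-ψ L2 (suc (suc c) ∷ rest) _ _ = refl
lastLetter-ψ Lu (zero ∷ rest) (π↭ , _) _ = ⊥-elim (¬IsPerm-0∷ π↭)
lastLetter-ψ Lu (suc zero ∷ rest) _ (_ , _ , c≢1) = ⊥-elim (c≢1 refl)
lastLetter-ψ Lu (suc (suc k) ∷ rest) _ _
  rewrite shiftFrom-≥ {suc (suc k)} {suc (suc k)} ≤-refl | ≡ᵇ-true {k} refl = refl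
lastLetter-ψ Ld (zero ∷ rest) (π↭ , _) _ = ⊥-elim (¬IsPerm-0∷ π↭)
lastLetter-ψ Ld (suc k ∷ rest) _ _
  rewrite shiftFrom-< {suc (suc k)} {suc k} ≤-refl
        | ≡ᵇ-false {suc k} {suc (suc (suc k))} (<⇒≢ (<-trans (n<1+n (suc k)) (n<1+n (suc (suc k)))))
        | ≡ᵇ-true {k} refl = refl

ρ-front-injective : ∀ i i′ π π′ → ρ i 1 π ≡ ρ i′ 1 π′ → π ≡ π′
ρ-front-injective i i′ π π′ eq with cong first eq
... | refl = map-shiftFrom-injective i π π′ (cong (drop 1) eq)

ψ-injective : ∀ l π π′ → InDomain l π → InDomain l π′ → ψ l π ≡ ψ l π′ → π ≡ π′
ψ-injective L1 π π′ _ _ = ρ-front-injective 1 1 π π′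
ψ-injective Lu π π′ _ _ = ρ-front-injective _ _ π π′
ψ-injective Ld π π′ _ _ = ρ-front-injective _ _ π π′
ψ-injective L2 (c ∷ rest) (c′ ∷ rest′) _ _ eq =
  cong₂ _∷_ (shiftFrom-injective 1 (cong first eq)) (map-shiftFrom-injective 1 rest rest′ (cong (drop 2) eq))

eval-length : ∀ w → Valid w → length (eval w) ≡ length w
eval-length w valid = IsPerm-length (proj₁ (proj₁ (eval-sound w valid)))

eval-injective : ∀ w v → Valid w → Valid v → eval w ≡ eval v → w ≡ v
eval-injective [] [] _ _ _ = refl
eval-injective [] (l ∷ v) _ valid eq =
  ⊥-elim (1+n≢0 (trans (sym (eval-length (l ∷ v) valid)) (cong length (sym eq))))
eval-injective (l ∷ w) [] valid _ eq =
  ⊥-elim (1+n≢0 (trans (sym (eval-length (l ∷ w) valid)) (cong length eq)))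
eval-injective (l ∷ w) (l′ ∷ v) (validw , inw) (validv , inv) eq
  with trans (sym (lastLetter-ψ l (eval w) (proj₁ (eval-sound w validw)) inw))
             (trans (cong lastLetter eq) (lastLetter-ψ l′ (eval v) (proj₁ (eval-sound v validv)) inv))
... | refl = cong (l ∷_) (eval-injective w v validw validv (ψ-injective l (eval w) (eval v) inw inv eq))

-- Surjectivity

StepIncreasing : (ℕ → ℕ) → Set
StepIncreasing f = ∀ u → f u < f (suc u)

StepIncreasing⇒mono-< : ∀ {f} → StepIncreasing f → ∀ {u v} → u < v → f u < f v
StepIncreasing⇒mono-< {f} inc {u} {suc v} (s≤s u≤v) with m≤n⇒m<n∨m≡n u≤v
... | inj₁ u<v = <-trans (StepIncreasing⇒mono-< inc u<v) (inc v)
... | inj₂ refl = inc u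

StepIncreasing⇒OrderPreservingOn : ∀ {f} s → StepIncreasing f → OrderPreservingOn f s
StepIncreasing⇒OrderPreservingOn {f} s inc u v _ _ = mk⇔ (StepIncreasing⇒mono-< inc) reflect
  where
  reflect : f u < f v → u < v
  reflect fu<fv with <-cmp u v
  ... | tri< u<v _ _ = u<v
  ... | tri≈ _ refl _ = ⊥-elim (<-irrefl refl fu<fv)
  ... | tri> _ _ v<u = ⊥-elim (<-asym fu<fv (StepIncreasing⇒mono-< inc v<u))

-- Realises a pattern of size 4 with the values 1 < lo < mid < hi; the other values only keep it increasing.
placeValues : ℕ → ℕ → ℕ → ℕ → ℕ
placeValues lo mid hi zero = 0
placeValues lo mid hi (suc zero) = 1
placeValues lo mid hi (suc (suc zero)) = lo
placeValues lo mid hi (suc (suc (suc zero))) = mid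
placeValues lo mid hi (suc (suc (suc (suc k)))) = k + hi

OrderIso-placeValues : ∀ {lo mid hi} p → 1 < lo → lo < mid → mid < hi → OrderIso (map (placeValues lo mid hi) p) p
OrderIso-placeValues {lo} {mid} {hi} p 1<lo lo<mid mid<hi =
  OrderIso-map⁺ (placeValues lo mid hi) p p (StepIncreasing⇒OrderPreservingOn p increasing)
    (refl , λ _ _ _ _ → ⇔-refl)
  where
  increasing : StepIncreasing (placeValues lo mid hi)
  increasing zero = z<s
  increasing (suc zero) = 1<lo
  increasing (suc (suc zero)) = lo<mid
  increasing (suc (suc (suc zero))) = mid<hi
  increasing (suc (suc (suc (suc k)))) = n<1+n (k + hi)

∈-pair-⊆ : ∀ {a b : ℕ} {l} → a ∈ l → b ∈ l → a ≢ b → (a ∷ b ∷ [] ⊆ l) ⊎ (b ∷ a ∷ [] ⊆ l)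
∈-pair-⊆ (here refl) (here refl) a≢b = ⊥-elim (a≢b refl)
∈-pair-⊆ (here refl) (there b∈) _ = inj₁ (refl ∷ from∈ b∈)
∈-pair-⊆ (there a∈) (here refl) _ = inj₂ (refl ∷ from∈ a∈)
∈-pair-⊆ {l = x ∷ l} (there a∈) (there b∈) a≢b with ∈-pair-⊆ a∈ b∈ a≢b
... | inj₁ ab⊆ = inj₁ (x ∷ʳ ab⊆)
... | inj₂ ba⊆ = inj₂ (x ∷ʳ ba⊆)

∈-drop-2 : ∀ {a x y : ℕ} {l} → a ∈ x ∷ y ∷ l → a ≢ x → a ≢ y → a ∈ l
∈-drop-2 (here a≡x) a≢x _ = ⊥-elim (a≢x a≡x)
∈-drop-2 (there (here a≡y)) _ a≢y = ⊥-elim (a≢y a≡y)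
∈-drop-2 (there (there a∈)) _ _ = a∈

IsPerm-1< : ∀ {N x π} → IsPerm N π → x ∈ π → x ≢ 1 → 1 < x
IsPerm-1< σ↭ x∈ x≢1 = ≤∧≢⇒< (proj₁ (IsPerm-∈⁻ σ↭ x∈)) (x≢1 ∘ sym)

tail-contains-1-and : ∀ {N x y τ} c → IsPerm N (x ∷ y ∷ τ) → x ≢ 1 → y ≢ 1 →
  1 < c → c ≤ N → c ≢ x → c ≢ y → (c ∷ 1 ∷ [] ⊆ τ) ⊎ (1 ∷ c ∷ [] ⊆ τ)
tail-contains-1-and c σ↭ x≢1 y≢1 1<c c≤N c≢x c≢y =
  ∈-pair-⊆ (∈-drop-2 (IsPerm-∈⁺ σ↭ (<⇒≤ 1<c) c≤N) c≢x c≢y)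
           (∈-drop-2 (IsPerm-∈⁺ σ↭ ≤-refl (≤-trans (IsPerm-head-positive σ↭) (IsPerm-head-≤ σ↭)))
                     (x≢1 ∘ sym) (y≢1 ∘ sym))
           (>⇒≢ 1<c)

-- In both lemmas lo + 1, with lo the smaller of the first two entries, completes a forbidden pattern with 1.
Rectangular-leading-< : ∀ {N x y τ} → RectPerm N (x ∷ y ∷ τ) → 1 < x → y ≢ 1 → suc x < y → ⊥
Rectangular-leading-< {x = x} (σ↭ , a₁ , a₂ , _) 1<x y≢1 x+1<y
  with tail-contains-1-and (suc x) σ↭ (<⇒≢ 1<x ∘ sym) y≢1 (m<n⇒m<1+n 1<x)
         (<⇒≤ (<-≤-trans x+1<y (proj₂ (IsPerm-∈⁻ σ↭ (there (here refl))))))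
         (<⇒≢ (n<1+n x) ∘ sym) (<⇒≢ x+1<y)
... | inj₁ c1⊆ = a₂ (_ , refl ∷ refl ∷ c1⊆ , OrderIso-placeValues _ 1<x (n<1+n x) x+1<y)
... | inj₂ 1c⊆ = a₁ (_ , refl ∷ refl ∷ 1c⊆ , OrderIso-placeValues _ 1<x (n<1+n x) x+1<y)

Rectangular-leading-> : ∀ {N x y τ} → RectPerm N (x ∷ y ∷ τ) → x ≢ 1 → 1 < y → suc y < x → ⊥
Rectangular-leading-> {y = y} (σ↭ , _ , _ , a₃ , a₄) x≢1 1<y y+1<x
  with tail-contains-1-and (suc y) σ↭ x≢1 (<⇒≢ 1<y ∘ sym) (m<n⇒m<1+n 1<y)
         (<⇒≤ (<-≤-trans y+1<x (IsPerm-head-≤ σ↭)))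
         (<⇒≢ y+1<x) (<⇒≢ (n<1+n y) ∘ sym)
... | inj₁ c1⊆ = a₄ (_ , refl ∷ refl ∷ c1⊆ , OrderIso-placeValues _ 1<y (n<1+n y) y+1<x)
... | inj₂ 1c⊆ = a₃ (_ , refl ∷ refl ∷ 1c⊆ , OrderIso-placeValues _ 1<y (n<1+n y) y+1<x)

Rectangular-leading : ∀ {N x y τ} → RectPerm N (x ∷ y ∷ τ) → x ≢ 1 → y ≢ 1 → y ≢ suc x → x ≢ suc y → ⊥
Rectangular-leading {x = x} {y} σ@(σ↭ , _) x≢1 y≢1 y≢x+1 x≢y+1 with <-cmp x y
... | tri< x<y _ _ =
  Rectangular-leading-< σ (IsPerm-1< σ↭ (here refl) x≢1) y≢1 (≤∧≢⇒< x<y (y≢x+1 ∘ sym))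
... | tri> _ _ y<x =
  Rectangular-leading-> σ x≢1 (IsPerm-1< σ↭ (there (here refl)) y≢1) (≤∧≢⇒< y<x (x≢y+1 ∘ sym))
... | tri≈ _ x≡y _ with IsPerm-Unique σ↭
...   | (x≢y ∷ _) ∷ _ = x≢y x≡y

-- σ = ψ letter preimage, also written as a ρ so that IsPerm and pattern containment transfer back to the preimage.
record Decomposition (m : ℕ) (σ : Perm) : Set where
  constructor decomposition
  field
    letter : Letter
    preimage : Perm
    value position : ℕ
    ψ-preimage : ψ letter preimage ≡ σ
    ρ-preimage : ρ value position preimage ≡ σ
    1≤value : 1 ≤ value
    value≤ : value ≤ suc m
    inDomain : Rectangular preimage → InDomain letter preimage

∈⇒1≤length-map : ∀ {a : ℕ} {l} (f : ℕ → ℕ) → a ∈ l → 1 ≤ length (map f l)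
∈⇒1≤length-map {l = _ ∷ _} _ _ = s≤s z≤n

decompose-ψ₁ : ∀ {m τ} → IsPerm (suc m) (1 ∷ τ) → Decomposition m (1 ∷ τ)
decompose-ψ₁ {τ = τ} σ↭ = decomposition L1 (map (unshiftFrom 1) τ) 1 1 eq eq ≤-refl z<s (λ rect → rect)
  where
  eq : ρ 1 1 (map (unshiftFrom 1) τ) ≡ 1 ∷ τ
  eq = cong (1 ∷_) (shiftFrom-unshiftFrom-map 1 τ (IsPerm-head∉ σ↭))

decompose-ψu : ∀ {m x τ} → IsPerm (suc m) (x ∷ suc x ∷ τ) → x ≢ 1 → Decomposition m (x ∷ suc x ∷ τ)
decompose-ψu {x = x} {τ} σ↭ x≢1 =
  decomposition Lu preimage x 1 (trans (cong (λ i → ρ i 1 preimage) (unshiftFrom-suc x)) eq) eq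
    (IsPerm-head-positive σ↭) (IsPerm-head-≤ σ↭) inDomain
  where
  preimage = map (unshiftFrom x) (suc x ∷ τ)
  eq : ρ x 1 preimage ≡ x ∷ suc x ∷ τ
  eq = cong (x ∷_) (shiftFrom-unshiftFrom-map x (suc x ∷ τ) (IsPerm-head∉ σ↭))
  1∈τ : 1 ∈ τ
  1∈τ = ∈-drop-2 (IsPerm-∈⁺ σ↭ ≤-refl (s≤s z≤n))
          (x≢1 ∘ sym) (<⇒≢ (IsPerm-head-positive σ↭) ∘ suc-injective)
  inDomain : Rectangular preimage → InDomain Lu preimage
  inDomain rect = rect , s≤s (∈⇒1≤length-map (unshiftFrom x) 1∈τ) , (x≢1 ∘ trans (sym (unshiftFrom-suc x)))

decompose-ψd : ∀ {m y τ} → IsPerm (suc m) (suc y ∷ y ∷ τ) → Decomposition m (suc y ∷ y ∷ τ)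
decompose-ψd {y = y} {τ} σ↭ =
  decomposition Ld preimage (suc y) 1 (trans (cong (λ i → ρ (suc i) 1 preimage) (unshiftFrom-pred y)) eq) eq
    (IsPerm-head-positive σ↭) (IsPerm-head-≤ σ↭) (λ rect → rect , s≤s z≤n)
  where
  preimage = map (unshiftFrom (suc y)) (y ∷ τ)
  eq : ρ (suc y) 1 preimage ≡ suc y ∷ y ∷ τ
  eq = cong (suc y ∷_) (shiftFrom-unshiftFrom-map (suc y) (y ∷ τ) (IsPerm-head∉ σ↭))

decompose-ψ₂ : ∀ {m x τ} → IsPerm (suc m) (x ∷ 1 ∷ τ) → x ≢ 1 → x ≢ 2 → Decomposition m (x ∷ 1 ∷ τ)
decompose-ψ₂ {x = x} {τ} σ↭ x≢1 x≢2 =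
  decomposition L2 preimage 1 2 eq eq ≤-refl z<s inDomain
  where
  preimage = map (unshiftFrom 1) (x ∷ τ)
  1∉τ : 1 ∉ τ
  1∉τ with IsPerm-Unique σ↭
  ... | _ ∷ (1≢ ∷ _) = All¬⇒¬Any 1≢
  eq : ρ 1 2 preimage ≡ x ∷ 1 ∷ τ
  eq = cong₂ _∷_ (shiftFrom-unshiftFrom 1 x x≢1) (cong (1 ∷_) (shiftFrom-unshiftFrom-map 1 τ 1∉τ))
  2∈τ : 2 ∈ τ
  2∈τ = ∈-drop-2 (IsPerm-∈⁺ σ↭ z<s (≤-trans (IsPerm-1< σ↭ (here refl) x≢1) (IsPerm-head-≤ σ↭)))
          (x≢2 ∘ sym) (λ ())
  inDomain : Rectangular preimage → InDomain L2 preimage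
  inDomain rect = rect , s≤s (∈⇒1≤length-map (unshiftFrom 1) 2∈τ) ,
                  (λ eq₁ → x≢2 (trans (sym (shiftFrom-unshiftFrom 1 x x≢1)) (cong (shiftFrom 1) eq₁)))

decompose : ∀ m σ → RectPerm (suc m) σ → Decomposition m σ
decompose m [] (σ↭ , _) = ⊥-elim (1+n≢0 (sym (IsPerm-length σ↭)))
decompose m (x ∷ τ) (σ↭ , rect) with x ≟ 1
... | yes refl = decompose-ψ₁ σ↭
decompose m (x ∷ []) (σ↭ , rect) | no x≢1 =
  ⊥-elim (x≢1 (≤-antisym (subst (x ≤_) (sym (IsPerm-length σ↭)) (IsPerm-head-≤ σ↭))
                          (IsPerm-head-positive σ↭)))
decompose m (x ∷ y ∷ τ) (σ↭ , rect) | no x≢1 with y ≟ suc x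
... | yes refl = decompose-ψu σ↭ x≢1
... | no y≢x+1 with x ≟ suc y
...   | yes refl = decompose-ψd σ↭
...   | no x≢y+1 with y ≟ 1
...     | yes refl = decompose-ψ₂ σ↭ x≢1 x≢y+1
...     | no y≢1 = ⊥-elim (Rectangular-leading (σ↭ , rect) x≢1 y≢1 y≢x+1 x≢y+1)

Decomposition-preimage-RectPerm : ∀ {m σ} (d : Decomposition m σ) → RectPerm (suc m) σ →
                                  RectPerm m (Decomposition.preimage d)
Decomposition-preimage-RectPerm {m} (decomposition _ π i j _ ρ≡ 1≤i i≤ _) (σ↭ , rect) =
  ρ-IsPerm⁻ i j 1≤i i≤ (subst (IsPerm (suc m)) (sym ρ≡) σ↭) ,
  Rectangular-lower (λ p contains → subst (λ σ → Contains σ p) ρ≡ (Contains-ρ i j π p contains)) rect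

eval-surjective : ∀ n π → RectPerm n π → ∃[ w ] (Valid w × length w ≡ n × eval w ≡ π)
eval-surjective zero π (π↭ , _) = [] , tt , refl , sym (↭-empty-inv π↭)
eval-surjective (suc m) π rectPerm with decompose m π rectPerm
... | d@(decomposition l π₀ _ _ ψ≡ _ _ _ inDomain)
  with Decomposition-preimage-RectPerm d rectPerm
... | rectPerm₀@(_ , rect₀) with eval-surjective m π₀ rectPerm₀
... | w , valid , refl , refl = l ∷ w , (valid , inDomain rect₀) , refl , ψ≡

mainTheorem8 : ∀ (n k : ℕ) → 1 ≤ n →
    (∀ w → WordSet n k w → PermSet n k (eval w)) ×
    (∀ w v → WordSet n k w → WordSet n k v → eval w ≡ eval v → w ≡ v) ×
    (∀ π → PermSet n k π → ∃[ w ] (WordSet n k w × eval w ≡ π))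
mainTheorem8 n k 1≤n = sound , injective , surjective
  where
  sound : ∀ w → WordSet n k w → PermSet n k (eval w)
  sound w ((_ , valid) , refl , refl) with eval-sound w valid
  ... | (π↭ , rect) , recoils≡ = π↭ , rect , recoils≡
  injective : ∀ w v → WordSet n k w → WordSet n k v → eval w ≡ eval v → w ≡ v
  injective w v ((_ , validw) , _) ((_ , validv) , _) = eval-injective w v validw validv
  surjective : ∀ π → PermSet n k π → ∃[ w ] (WordSet n k w × eval w ≡ π)
  surjective π (π↭ , rect , refl) with eval-surjective n π (π↭ , rect)
  ... | w , valid , refl , refl =
    w , (((λ { refl → <⇒≢ 1≤n refl }) , valid) , refl , sym (proj₂ (eval-sound w valid))) , refl
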